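{- Let $n\geq2$ be even. Then: (a) $G_n$ is an Abelian monoid with respect to composition of functions, and the map $\varphi:G_n\to\mathcal{M}_n$, $\varphi\big(\sum_{i=0}^{t}a_i\gamma_{2i}\big)=\big[\sum_{i=0}^{t}a_iX^i\big]$, is a monoid isomorphism (with $\mathcal{M}_n$ a monoid under multiplication in $\mathcal{R}_n$). In particular $G_n\cong\mathcal{M}_n$. (b) The set $G_n^*$ of invertible (equivalently, bijective) functions in $G_n$ is an Abelian group under composition, isomorphic to the unit group $\mathcal{R}_n^*=\mathcal{M}_n^*$ of $\mathcal{R}_n$.
   Context: Let $\mathbbm{1}=(1,\dots,1)\in\mathbb{F}_2^n$, let $\odot$ denote component-wise multiplication in $\mathbb{F}_2^n$, and let $S(x_1,\dots,x_n)=(x_2,\dots,x_n,x_1)$. Define $\gamma_0=\mathrm{id}$ and, for $k\geq1$, $\gamma_{2k}(x)=S^{2k}(x)\odot(\mathbbm{1}+S^{2k-1}(x))\odot(\mathbbm{1}+S^{2k-3}(x))\odot\cdots\odot(\mathbbm{1}+S(x))$, as functions $\mathbb{F}_2^n\to\mathbb{F}_2^n$. Let $\Gamma_n$ be the $\mathbb{F}_2$-span of all $\gamma_{2k}$, $k\ge 0$ (functions added pointwise); for even $n$ it has basis $\gamma_0,\gamma_2,\dots,\gamma_{2n-2}$. Let $G_n=\gamma_0+\mathrm{span}_{\mathbb{F}_2}\{\gamma_2,\gamma_4,\dots,\gamma_{2n-2}\}$. Let $\mathcal{R}_n=\mathbb{F}_2[X]/(X^n+X^{n/2})$, with $[f]$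 the class of $f\in\mathbb{F}_2[X]$, and let $\mathcal{M}_n=\{[1+\sum_{i=1}^ta_iX^i]: t\geq1, a_i\in\mathbb{F}_2\}\subseteq\mathcal{R}_n$. The map $\varphi:\Gamma_n\to\mathcal{R}_n$, $\sum_i a_i\gamma_{2i}\mapsto[\sum_i a_iX^i]$, is a well-defined bijection. -}

module Defs where

open import Data.Bool using (Bool; true; false; _∧_; _xor_; if_then_else_)
open import Data.Nat using (ℕ; zero; suc; _+_; _*_; ⌊_/2⌋)
open import Data.Vec using (Vec; []; _∷_; _∷ʳ_; zipWith; replicate; toList)
open import Data.List as L using (List; []; _∷_; _++_)
open import Data.List.Relation.Unary.All using (All)
open import Data.Product using (Σ; ∃; _×_)
open import Relation.Binary.PropositionalEquality using (_≡_; _≗_)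
open import Function using (_∘_; id)

V : ℕ → Set
V n = Vec Bool n

𝟙 : ∀ {n} → V n
𝟙 {n} = replicate n true

𝟘 : ∀ {n} → V n
𝟘 {n} = replicate n false

_⊕_ : ∀ {n} → V n → V n → V n
_⊕_ = zipWith _xor_

_⊙_ : ∀ {n} → V n → V n → V n
_⊙_ = zipWith _∧_

S : ∀ {n} → V n → V n
S [] = []
S (x ∷ xs) = xs ∷ʳ x

Sᵏ : ∀ {n} → ℕ → V n → V n
Sᵏ zero x = x
Sᵏ (suc k) x = S (Sᵏ k x)

P : ∀ {n} → ℕ → V n → V n
P zero x = 𝟙
P (suc k) x = P k x ⊙ (𝟙 ⊕ Sᵏ (suc (2 * k)) x)

-- γ k is the paper's γ_{2k}:  γ_{2k}(x) = S^{2k}(x) ⊙ P k x ; γ 0 = id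
γ : ∀ {n} → ℕ → V n → V n
γ k x = Sᵏ (2 * k) x ⊙ P k x

combFrom : ∀ {n} → ℕ → List Bool → V n → V n
combFrom i [] x = 𝟘
combFrom i (b ∷ bs) x = (if b then γ i x else 𝟘) ⊕ combFrom (suc i) bs x

Γfun : ∀ {n} → Vec Bool n → V n → V n
Γfun a = combFrom 0 (toList a)

-- Polynomials over F₂ (coefficient lists, lowest degree first)

Poly : Set
Poly = List Bool

_+ₚ_ : Poly → Poly → Poly
[] +ₚ q = q
(a ∷ p) +ₚ [] = a ∷ p
(a ∷ p) +ₚ (b ∷ q) = (a xor b) ∷ (p +ₚ q)

_·ₚ_ : Bool → Poly → Poly
b ·ₚ p = L.map (b ∧_) p

_*ₚ_ : Poly → Poly → Poly
[] *ₚ q = []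
(a ∷ p) *ₚ q = (a ·ₚ q) +ₚ (false ∷ (p *ₚ q))

IsZeroₚ : Poly → Set
IsZeroₚ p = All (_≡ false) p

oneₚ : Poly
oneₚ = true ∷ []

monomial : ℕ → Poly
monomial k = L.replicate k false ++ (true ∷ [])

const : Poly → Bool
const [] = false
const (b ∷ _) = b

-- R_n = F₂[X]/(X^n + X^{n/2}) as polynomials modulo the congruence

modulus : ℕ → Poly
modulus n = monomial n +ₚ monomial ⌊ n /2⌋

_≡[_]_ : Poly → ℕ → Poly → Set
p ≡[ n ] q = ∃ λ (c : Poly) → IsZeroₚ ((p +ₚ q) +ₚ (c *ₚ modulus n))

InM : ℕ → Poly → Set
InM n r = Σ Poly λ p → const p ≡ true × p ≡[ n ] r

IsUnitR : ℕ → Poly → Set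
IsUnitR n r = Σ Poly λ s → (r *ₚ s) ≡[ n ] oneₚ

Lead : ∀ {n} → Vec Bool n → Set
Lead a = const (toList a) ≡ true

-- f ∈ G_n = γ_0 + span{γ_2,…,γ_{2n-2}}  (functions compared pointwise)
InG : (n : ℕ) → (V n → V n) → Set
InG n f = Σ (Vec Bool n) λ a → Lead a × (f ≗ Γfun a)

φ : ∀ {n} → Vec Bool n → Poly
φ a = toList a

InvG : (n : ℕ) → (V n → V n) → Set
InvG n f = InG n f × Σ (V n → V n) λ g → InG n g × (f ∘ g ≗ id) × (g ∘ f ≗ id)

Bijective : ∀ {n} → (V n → V n) → Set
Bijective f = (∀ x y → f x ≡ f y → x ≡ y) × (∀ y → ∃ λ x → f x ≡ y)

-- Read x ∈ F₂ⁿ as the n-periodic stream s of its entries. Then γ_{2k}(x) is given by the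
-- Horner-type recursion γ_{2k+2}(x)_i = ¬s_{i+1} ∧ γ_{2k}(x)_{i+2}, and Σ b_t γ_{2t} sends x to the
-- stream i ↦ ⟦ b ⟧ (t ↦ γ_{2t}(x)_i), where ⟦ b ⟧ g = Σ b_t g_t. Since γ_{2p}(x)_{j+1} and
-- γ_{2q+2}(x)_j are never both 1, composing γ_{2k} with a combination whose γ_0-coefficient is 1
-- shifts all its indices by k: composition is multiplication of coefficient polynomials. The
-- sequence t ↦ γ_{2t}(x)_i satisfies γ_{2(t+n)} = γ_{2(t+n/2)} by periodicity, so a combination only
-- depends on the class of its polynomial in R_n, and test vectors with prescribed odd entries show
-- that γ_0, …, γ_{2n-2} are linearly independent. Finally, if Σ a_t γ_{2t} is surjective, then
-- [c] ↦ [c·a] is injective on the finite set F₂ⁿ, hence hits 1.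

module Submission where

open import Defs
open import Data.Nat using (ℕ; _≤_)
open import Data.Nat.Divisibility using (_∣_)
open import Data.Vec using (Vec)
open import Data.Bool using (Bool)
open import Data.Product using (Σ; _×_)
open import Function using (_∘_; id)
open import Function.Bundles using (_⇔_)
open import Relation.Binary.PropositionalEquality using (_≗_)

open import Data.Bool using (true; false; not; _∧_; _∨_; _xor_; if_then_else_)
open import Data.Bool.Properties
  using ( ∧-assoc; ∧-comm; ∧-idem; ∧-zeroʳ; ∧-identityʳ; ∧-inverseˡ; ∧-conicalˡ; ∧-conicalʳ
        ; ∧-distribˡ-xor; ∧-distribʳ-xor; ∨-zeroʳ; xor-comm; xor-assoc; xor-identityʳ; xor-same )
open import Data.Bool.Solver using (module xor-∧-Solver)
open import Data.Nat using (zero; suc; _+_; _*_; _∸_; _^_; _<_; s≤s; z≤n; ⌊_/2⌋; _≟_)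
import Data.Nat.Properties as ℕ
open import Data.Nat.Divisibility using (divides)
open import Data.Nat.Tactic.RingSolver using (solve-∀)
open import Data.Fin as Fin using (Fin; toℕ; fromℕ<)
open import Data.Fin.Properties
  using (any?; pigeonhole; punchOut-injective; 2↔Bool; *↔×; toℕ<n; fromℕ<-toℕ; toℕ-fromℕ<)
  renaming (_≟_ to _≟ᶠ_)
open import Data.Vec as Vec
  using ([]; _∷_; _∷ʳ_; head; init; last; initLast; lookup; tabulate; zipWith; replicate; toList)
import Data.Vec.Properties as Vec
open import Data.List as List using ([]; _∷_; _++_; length)
import Data.List.Properties as List
open import Data.List.Relation.Unary.All using ([]; _∷_)
open import Data.Product using (∃; _,_; proj₁; proj₂)
open import Data.Product.Function.NonDependent.Propositional using (_×-↔_)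
open import Data.Empty using (⊥; ⊥-elim)
open import Function using (_↔_; Inverse; mk↔ₛ′; mk⇔)
open import Function.Construct.Composition using (_↔-∘_)
open import Function.Construct.Symmetry using (↔-sym)
open import Relation.Nullary using (¬_; yes; no; does)
open import Relation.Nullary.Decidable using (dec-true; dec-false)
open import Relation.Binary.PropositionalEquality
  using (_≡_; _≢_; refl; sym; trans; cong; cong₂; subst; subst₂; module ≡-Reasoning)

xor≡false⇒≡ : ∀ {x y} → x xor y ≡ false → x ≡ y
xor≡false⇒≡ {true} {true} _ = refl
xor≡false⇒≡ {false} {false} _ = refl

xor-medial : ∀ u v w z → (u xor v) xor (w xor z) ≡ (u xor w) xor (v xor z)
xor-medial = solve 4 (λ u v w z → (u :+ v) :+ (w :+ z) := (u :+ w) :+ (v :+ z)) refl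
  where open xor-∧-Solver

xor-cancel-middle : ∀ x y z → x xor z ≡ (x xor y) xor (y xor z)
xor-cancel-middle = solve 3 (λ x y z → x :+ z := (x :+ y) :+ (y :+ z)) refl
  where open xor-∧-Solver

∧-∧-≡false : ∀ x {y} z {w} → y ∧ w ≡ false → (x ∧ y) ∧ (z ∧ w) ≡ false
∧-∧-≡false false z _ = refl
∧-∧-≡false true {y} false _ = ∧-zeroʳ y
∧-∧-≡false true true y∧w≡false = y∧w≡false

not-xor-∧ : ∀ x {d c} → c ∧ d ≡ false → not (x xor d) ∧ c ≡ not x ∧ c
not-xor-∧ x {false} {c} _ = cong (λ y → not y ∧ c) (xor-identityʳ x)
not-xor-∧ x {true} {false} _ = trans (∧-zeroʳ _) (sym (∧-zeroʳ _))

-- Polynomials acting on Boolean sequences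

Seq : Set
Seq = ℕ → Bool

⟦_⟧ : Poly → Seq → Bool
⟦ [] ⟧ g = false
⟦ b ∷ p ⟧ g = (b ∧ g 0) xor ⟦ p ⟧ (g ∘ suc)

_↑_ : Seq → ℕ → Seq
(g ↑ k) t = g (k + t)

⟦⟧-cong : ∀ p {g h : Seq} → g ≗ h → ⟦ p ⟧ g ≡ ⟦ p ⟧ h
⟦⟧-cong [] g≗h = refl
⟦⟧-cong (b ∷ p) g≗h = cong₂ (λ x y → (b ∧ x) xor y) (g≗h 0) (⟦⟧-cong p (g≗h ∘ suc))

⟦⟧-+ : ∀ p q g → ⟦ p +ₚ q ⟧ g ≡ ⟦ p ⟧ g xor ⟦ q ⟧ g
⟦⟧-+ [] q g = refl
⟦⟧-+ (a ∷ p) [] g = sym (xor-identityʳ _)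
⟦⟧-+ (a ∷ p) (b ∷ q) g = begin
  ((a xor b) ∧ g 0) xor ⟦ p +ₚ q ⟧ (g ∘ suc)
    ≡⟨ cong₂ _xor_ (∧-distribʳ-xor (g 0) a b) (⟦⟧-+ p q (g ∘ suc)) ⟩
  ((a ∧ g 0) xor (b ∧ g 0)) xor (⟦ p ⟧ (g ∘ suc) xor ⟦ q ⟧ (g ∘ suc))
    ≡⟨ xor-medial (a ∧ g 0) (b ∧ g 0) (⟦ p ⟧ (g ∘ suc)) (⟦ q ⟧ (g ∘ suc)) ⟩
  ⟦ a ∷ p ⟧ g xor ⟦ b ∷ q ⟧ g ∎
  where open ≡-Reasoning

⟦⟧-· : ∀ b p g → ⟦ b ·ₚ p ⟧ g ≡ b ∧ ⟦ p ⟧ g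
⟦⟧-· b [] g = sym (∧-zeroʳ b)
⟦⟧-· b (a ∷ p) g =
  trans (cong₂ _xor_ (∧-assoc b a (g 0)) (⟦⟧-· b p (g ∘ suc))) (sym (∧-distribˡ-xor b _ _))

⟦⟧-xorˢ : ∀ p g h → ⟦ p ⟧ (λ t → g t xor h t) ≡ ⟦ p ⟧ g xor ⟦ p ⟧ h
⟦⟧-xorˢ [] g h = refl
⟦⟧-xorˢ (a ∷ p) g h =
  trans (cong₂ _xor_ (∧-distribˡ-xor a (g 0) (h 0)) (⟦⟧-xorˢ p (g ∘ suc) (h ∘ suc)))
        (xor-medial (a ∧ g 0) (a ∧ h 0) (⟦ p ⟧ (g ∘ suc)) (⟦ p ⟧ (h ∘ suc)))

⟦⟧-∧ˢ : ∀ p b g → ⟦ p ⟧ (λ t → b ∧ g t) ≡ b ∧ ⟦ p ⟧ g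
⟦⟧-∧ˢ [] b g = sym (∧-zeroʳ b)
⟦⟧-∧ˢ (a ∷ p) b g = trans (cong₂ _xor_ (swap a) (⟦⟧-∧ˢ p b (g ∘ suc))) (sym (∧-distribˡ-xor b _ _))
  where
  swap : ∀ a → a ∧ (b ∧ g 0) ≡ b ∧ (a ∧ g 0)
  swap a = trans (sym (∧-assoc a b (g 0))) (trans (cong (_∧ g 0) (∧-comm a b)) (∧-assoc b a (g 0)))

⟦⟧-false : ∀ p → ⟦ p ⟧ (λ _ → false) ≡ false
⟦⟧-false p = ⟦⟧-∧ˢ p false (λ _ → false)

⟦⟧-* : ∀ p q g → ⟦ p *ₚ q ⟧ g ≡ ⟦ p ⟧ (λ t → ⟦ q ⟧ (g ↑ t))
⟦⟧-* [] q g = refl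
⟦⟧-* (a ∷ p) q g = trans (⟦⟧-+ (a ·ₚ q) (false ∷ (p *ₚ q)) g)
                         (cong₂ _xor_ (⟦⟧-· a q g) (⟦⟧-* p q (g ∘ suc)))

⟦⟧-swap : ∀ p q (h : ℕ → Seq) → ⟦ p ⟧ (λ t → ⟦ q ⟧ (h t)) ≡ ⟦ q ⟧ (λ u → ⟦ p ⟧ (λ t → h t u))
⟦⟧-swap [] q h = sym (⟦⟧-false q)
⟦⟧-swap (a ∷ p) q h = begin
  (a ∧ ⟦ q ⟧ (h 0)) xor ⟦ p ⟧ (λ t → ⟦ q ⟧ (h (suc t)))
    ≡⟨ cong₂ _xor_ (sym (⟦⟧-∧ˢ q a (h 0))) (⟦⟧-swap p q (h ∘ suc)) ⟩
  ⟦ q ⟧ (λ u → a ∧ h 0 u) xor ⟦ q ⟧ (λ u → ⟦ p ⟧ (λ t → h (suc t) u))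
    ≡⟨ sym (⟦⟧-xorˢ q _ _) ⟩
  ⟦ q ⟧ (λ u → ⟦ a ∷ p ⟧ (λ t → h t u)) ∎
  where open ≡-Reasoning

⟦⟧-*-comm : ∀ p q g → ⟦ p *ₚ q ⟧ g ≡ ⟦ q *ₚ p ⟧ g
⟦⟧-*-comm p q g = begin
  ⟦ p *ₚ q ⟧ g                                 ≡⟨ ⟦⟧-* p q g ⟩
  ⟦ p ⟧ (λ t → ⟦ q ⟧ (λ u → g (t + u)))         ≡⟨ ⟦⟧-swap p q _ ⟩
  ⟦ q ⟧ (λ u → ⟦ p ⟧ (λ t → g (t + u)))         ≡⟨ ⟦⟧-cong q (λ u → ⟦⟧-cong p (λ t → cong g (ℕ.+-comm t u))) ⟩
  ⟦ q ⟧ (λ u → ⟦ p ⟧ (λ t → g (u + t)))         ≡⟨ sym (⟦⟧-* q p g) ⟩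
  ⟦ q *ₚ p ⟧ g ∎
  where open ≡-Reasoning

⟦⟧-monomial : ∀ k g → ⟦ monomial k ⟧ g ≡ g k
⟦⟧-monomial zero g = xor-identityʳ _
⟦⟧-monomial (suc k) g = ⟦⟧-monomial k (g ∘ suc)

⟦⟧-orthogonal : ∀ p q {g h : Seq} → (∀ t u → g t ∧ h u ≡ false) → ⟦ p ⟧ g ∧ ⟦ q ⟧ h ≡ false
⟦⟧-orthogonal [] q ⊥gh = refl
⟦⟧-orthogonal (a ∷ p) q {g} {h} ⊥gh = begin
  ((a ∧ g 0) xor ⟦ p ⟧ (g ∘ suc)) ∧ ⟦ q ⟧ h
    ≡⟨ ∧-distribʳ-xor _ (a ∧ g 0) _ ⟩
  ((a ∧ g 0) ∧ ⟦ q ⟧ h) xor (⟦ p ⟧ (g ∘ suc) ∧ ⟦ q ⟧ h)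
    ≡⟨ cong₂ _xor_ head-term (⟦⟧-orthogonal p q (⊥gh ∘ suc)) ⟩
  false ∎
  where
  open ≡-Reasoning
  head-term : (a ∧ g 0) ∧ ⟦ q ⟧ h ≡ false
  head-term = begin
    (a ∧ g 0) ∧ ⟦ q ⟧ h                 ≡⟨ ∧-assoc a (g 0) _ ⟩
    a ∧ (g 0 ∧ ⟦ q ⟧ h)                 ≡⟨ cong (a ∧_) (sym (⟦⟧-∧ˢ q (g 0) h)) ⟩
    a ∧ ⟦ q ⟧ (λ u → g 0 ∧ h u)         ≡⟨ cong (a ∧_) (trans (⟦⟧-cong q (⊥gh 0)) (⟦⟧-false q)) ⟩
    a ∧ false                            ≡⟨ ∧-zeroʳ a ⟩
    false ∎

⟦⟧-IsZero : ∀ {p} → IsZeroₚ p → ∀ g → ⟦ p ⟧ g ≡ false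
⟦⟧-IsZero [] g = refl
⟦⟧-IsZero (refl ∷ z) g = ⟦⟧-IsZero z (g ∘ suc)

IsZero-⟦⟧ : ∀ p → (∀ g → ⟦ p ⟧ g ≡ false) → IsZeroₚ p
IsZero-⟦⟧ [] _ = []
IsZero-⟦⟧ (b ∷ p) vanish = head-false ∷ IsZero-⟦⟧ p tail-vanish
  where
  open ≡-Reasoning
  δ₀ : Seq
  δ₀ zero = true
  δ₀ (suc _) = false
  head-false : b ≡ false
  head-false = begin
    b                                ≡⟨ sym (∧-identityʳ b) ⟩
    b ∧ true                         ≡⟨ sym (xor-identityʳ _) ⟩
    (b ∧ true) xor false             ≡⟨ cong ((b ∧ true) xor_) (sym (⟦⟧-false p)) ⟩
    ⟦ b ∷ p ⟧ δ₀                     ≡⟨ vanish δ₀ ⟩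
    false                            ∎
  tail-vanish : ∀ g → ⟦ p ⟧ g ≡ false
  tail-vanish g = trans (cong (_xor ⟦ p ⟧ g) (sym (∧-zeroʳ b))) (vanish λ { zero → false ; (suc t) → g t })

-- Congruence modulo X^n + X^{n/2}

≡[]-intro : ∀ n p q c → (∀ g → ⟦ p ⟧ g xor ⟦ q ⟧ g ≡ ⟦ c *ₚ modulus n ⟧ g) → p ≡[ n ] q
≡[]-intro n p q c h = c , IsZero-⟦⟧ _ λ g →
  trans (⟦⟧-+ (p +ₚ q) (c *ₚ modulus n) g)
        (trans (cong₂ _xor_ (⟦⟧-+ p q g) (sym (h g))) (xor-same (⟦ p ⟧ g xor ⟦ q ⟧ g)))

≡[]-elim : ∀ n p q → p ≡[ n ] q → ∃ λ c → ∀ g → ⟦ p ⟧ g xor ⟦ q ⟧ g ≡ ⟦ c *ₚ modulus n ⟧ g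
≡[]-elim n p q (c , z) = c , λ g → xor≡false⇒≡ (begin
  (⟦ p ⟧ g xor ⟦ q ⟧ g) xor ⟦ c *ₚ modulus n ⟧ g  ≡⟨ cong (_xor _) (sym (⟦⟧-+ p q g)) ⟩
  ⟦ p +ₚ q ⟧ g xor ⟦ c *ₚ modulus n ⟧ g           ≡⟨ sym (⟦⟧-+ (p +ₚ q) _ g) ⟩
  ⟦ (p +ₚ q) +ₚ (c *ₚ modulus n) ⟧ g              ≡⟨ ⟦⟧-IsZero z g ⟩
  false                                            ∎)
  where open ≡-Reasoning

≈⇒≡[] : ∀ {n p q} → (∀ g → ⟦ p ⟧ g ≡ ⟦ q ⟧ g) → p ≡[ n ] q
≈⇒≡[] {n} {p} {q} p≈q = ≡[]-intro n p q [] λ g → trans (cong (_xor ⟦ q ⟧ g) (p≈q g)) (xor-same (⟦ q ⟧ g))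

≡[]-refl : ∀ {n} p → p ≡[ n ] p
≡[]-refl {n} p = ≈⇒≡[] {n} {p} {p} λ _ → refl

≡[]-sym : ∀ {n p q} → p ≡[ n ] q → q ≡[ n ] p
≡[]-sym {n} {p} {q} p≡q with c , h ← ≡[]-elim n p q p≡q = ≡[]-intro n q p c λ g → trans (xor-comm (⟦ q ⟧ g) (⟦ p ⟧ g)) (h g)

≡[]-trans : ∀ {n p q r} → p ≡[ n ] q → q ≡[ n ] r → p ≡[ n ] r
≡[]-trans {n} {p} {q} {r} p≡q q≡r
  with c , hc ← ≡[]-elim n p q p≡q | d , hd ← ≡[]-elim n q r q≡r = ≡[]-intro n p r (c +ₚ d) λ g → begin
    ⟦ p ⟧ g xor ⟦ r ⟧ g                                       ≡⟨ xor-cancel-middle (⟦ p ⟧ g) (⟦ q ⟧ g) (⟦ r ⟧ g) ⟩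
    (⟦ p ⟧ g xor ⟦ q ⟧ g) xor (⟦ q ⟧ g xor ⟦ r ⟧ g)           ≡⟨ cong₂ _xor_ (hc g) (hd g) ⟩
    ⟦ c *ₚ modulus n ⟧ g xor ⟦ d *ₚ modulus n ⟧ g             ≡⟨ cong₂ _xor_ (⟦⟧-* c _ g) (⟦⟧-* d _ g) ⟩
    ⟦ c ⟧ (λ t → ⟦ modulus n ⟧ (g ↑ t)) xor ⟦ d ⟧ (λ t → ⟦ modulus n ⟧ (g ↑ t))
                                                              ≡⟨ sym (⟦⟧-+ c d _) ⟩
    ⟦ c +ₚ d ⟧ (λ t → ⟦ modulus n ⟧ (g ↑ t))                  ≡⟨ sym (⟦⟧-* (c +ₚ d) _ g) ⟩
    ⟦ (c +ₚ d) *ₚ modulus n ⟧ g                               ∎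
  where open ≡-Reasoning

Annihilates : Poly → Seq → Set
Annihilates m g = ∀ t → ⟦ m ⟧ (g ↑ t) ≡ false

⟦⟧-resp-≡[] : ∀ {n p q g} → Annihilates (modulus n) g → p ≡[ n ] q → ⟦ p ⟧ g ≡ ⟦ q ⟧ g
⟦⟧-resp-≡[] {n} {p} {q} {g} ann p≡q with c , h ← ≡[]-elim n p q p≡q = xor≡false⇒≡ (begin
  ⟦ p ⟧ g xor ⟦ q ⟧ g                          ≡⟨ h g ⟩
  ⟦ c *ₚ modulus n ⟧ g                         ≡⟨ ⟦⟧-* c _ g ⟩
  ⟦ c ⟧ (λ t → ⟦ modulus n ⟧ (g ↑ t))          ≡⟨ ⟦⟧-cong c ann ⟩
  ⟦ c ⟧ (λ _ → false)                          ≡⟨ ⟦⟧-false c ⟩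
  false                                        ∎)
  where open ≡-Reasoning

const-+ : ∀ p q → const (p +ₚ q) ≡ const p xor const q
const-+ [] q = refl
const-+ (a ∷ p) [] = sym (xor-identityʳ a)
const-+ (a ∷ p) (b ∷ q) = refl

const-· : ∀ b p → const (b ·ₚ p) ≡ b ∧ const p
const-· b [] = sym (∧-zeroʳ b)
const-· b (a ∷ p) = refl

const-* : ∀ p q → const (p *ₚ q) ≡ const p ∧ const q
const-* [] q = refl
const-* (a ∷ p) q = trans (const-+ (a ·ₚ q) _) (trans (xor-identityʳ _) (const-· a q))

const-IsZero : ∀ {p} → IsZeroₚ p → const p ≡ false
const-IsZero [] = refl
const-IsZero (p₀≡false ∷ _) = p₀≡false

const-resp-≡[] : ∀ {n p q} → const (modulus n) ≡ false → p ≡[ n ] q → const p ≡ const q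
const-resp-≡[] {n} {p} {q} const-m≡false (c , z) = xor≡false⇒≡ (begin
  const p xor const q                              ≡⟨ sym (xor-identityʳ (const p xor const q)) ⟩
  (const p xor const q) xor false                  ≡⟨ cong ((const p xor const q) xor_) (sym const-cm) ⟩
  (const p xor const q) xor const (c *ₚ modulus n) ≡⟨ cong (_xor _) (sym (const-+ p q)) ⟩
  const (p +ₚ q) xor const (c *ₚ modulus n)        ≡⟨ sym (const-+ (p +ₚ q) _) ⟩
  const ((p +ₚ q) +ₚ (c *ₚ modulus n))             ≡⟨ const-IsZero z ⟩
  false                                            ∎)
  where
  open ≡-Reasoning
  const-cm : const (c *ₚ modulus n) ≡ false
  const-cm = trans (const-* c _) (trans (cong (const c ∧_) const-m≡false) (∧-zeroʳ _))

-- Linear independence and finiteness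

Separating : {I : Set} → (I → Seq) → ℕ → Set
Separating {I} f N = ∀ k → k < N → Σ I λ x → f x k ≡ true × (∀ j → k < j → j < N → f x j ≡ false)

⟦⟧-vanishing : ∀ p g → (∀ t → t < length p → g t ≡ false) → ⟦ p ⟧ g ≡ false
⟦⟧-vanishing [] g _ = refl
⟦⟧-vanishing (b ∷ p) g g≡false =
  cong₂ _xor_ (trans (cong (b ∧_) (g≡false 0 (s≤s z≤n))) (∧-zeroʳ b))
              (⟦⟧-vanishing p (g ∘ suc) λ t t<len → g≡false (suc t) (s≤s t<len))

separating⇒IsZero : ∀ {I} (f : I → Seq) N p → Separating f N → length p ≤ N →
                    (∀ x → ⟦ p ⟧ (f x) ≡ false) → IsZeroₚ p
separating⇒IsZero f N [] _ _ _ = []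
separating⇒IsZero f (suc N) (b ∷ p) sep (s≤s len≤N) vanish =
  b≡false ∷ separating⇒IsZero (λ x → f x ∘ suc) N p sep-tail len≤N vanish-tail
  where
  open ≡-Reasoning
  b≡false : b ≡ false
  b≡false with x , fx0 , fx-rest ← sep 0 (s≤s z≤n) = begin
    b                                     ≡⟨ sym (trans (xor-identityʳ _) (∧-identityʳ b)) ⟩
    (b ∧ true) xor false                  ≡⟨ cong₂ (λ u v → (b ∧ u) xor v) (sym fx0) (sym rest-vanishes) ⟩
    ⟦ b ∷ p ⟧ (f x)                       ≡⟨ vanish x ⟩
    false                                 ∎
    where
    rest-vanishes : ⟦ p ⟧ (f x ∘ suc) ≡ false
    rest-vanishes = ⟦⟧-vanishing p (f x ∘ suc) λ t t<len →
      fx-rest (suc t) (s≤s z≤n) (s≤s (ℕ.<-≤-trans t<len len≤N))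
  sep-tail : Separating (λ x → f x ∘ suc) N
  sep-tail k k<N with x , fx , fx-rest ← sep (suc k) (s≤s k<N) =
    x , fx , λ j k<j j<N → fx-rest (suc j) (s≤s k<j) (s≤s j<N)
  vanish-tail : ∀ x → ⟦ p ⟧ (f x ∘ suc) ≡ false
  vanish-tail x = trans (cong (λ c → (c ∧ f x 0) xor ⟦ p ⟧ (f x ∘ suc)) (sym b≡false)) (vanish x)

Fin-injective⇒surjective : ∀ {N} (h : Fin N → Fin N) → (∀ {x y} → h x ≡ h y → x ≡ y) →
                           ∀ y → ∃ λ x → h x ≡ y
Fin-injective⇒surjective h inj y with any? (λ x → h x ≟ᶠ y)
... | yes hit = hit
... | no miss = ⊥-elim (no-miss h inj y miss)
  where
  no-miss : ∀ {N} (h : Fin N → Fin N) → (∀ {x y} → h x ≡ h y → x ≡ y) →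
            ∀ y → ¬ (∃ λ x → h x ≡ y) → ⊥
  no-miss {suc N} h inj y miss = collision
    where
    avoids : ∀ x → y ≢ h x
    avoids x y≡hx = miss (x , sym y≡hx)
    collision : ⊥
    collision with i , j , i<j , same ← pigeonhole (ℕ.n<1+n N) (λ x → Fin.punchOut (avoids x))
      = ℕ.<⇒≢ i<j (cong Fin.toℕ (inj (punchOut-injective (avoids i) (avoids j) same)))

injective⇒surjective : ∀ {A : Set} {N} → A ↔ Fin N → (h : A → A) →
                       (∀ {x y} → h x ≡ h y → x ≡ y) → ∀ y → ∃ λ x → h x ≡ y
injective⇒surjective A↔Fin h inj y = from x , to-injective (proj₂ hit)
  where
  open Inverse A↔Fin
  to-injective : ∀ {a b} → to a ≡ to b → a ≡ b
  to-injective {a} {b} e = trans (sym (strictlyInverseʳ a)) (trans (cong from e) (strictlyInverseʳ b))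
  conj-injective : ∀ {i j} → to (h (from i)) ≡ to (h (from j)) → i ≡ j
  conj-injective {i} {j} e =
    trans (sym (strictlyInverseˡ i)) (trans (cong to (inj (to-injective e))) (strictlyInverseˡ j))
  hit = Fin-injective⇒surjective (to ∘ h ∘ from) conj-injective (to y)
  x = proj₁ hit

Vec-Bool↔Fin : ∀ k → Vec Bool k ↔ Fin (2 ^ k)
Vec-Bool↔Fin zero = mk↔ₛ′ (λ _ → Fin.zero) (λ _ → []) (λ { Fin.zero → refl ; (Fin.suc ()) }) (λ { [] → refl })
Vec-Bool↔Fin (suc k) = ↔-sym *↔× ↔-∘ ((↔-sym 2↔Bool ×-↔ Vec-Bool↔Fin k) ↔-∘ uncons)
  where
  uncons : Vec Bool (suc k) ↔ (Bool × Vec Bool k)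
  uncons = mk↔ₛ′ (λ { (b ∷ w) → b , w }) (λ (b , w) → b ∷ w) (λ _ → refl) (λ { (b ∷ w) → refl })

-- The maps γ_{2k} on streams

Periodic : ℕ → Seq → Set
Periodic N s = ∀ i → s (i + N) ≡ s i

-- gate s k h i = h (i + 2k) ∧ ∏_{l<k} ¬ s (i + 2l + 1), so γˢ k s = gate s k s is γ_{2k} read on streams.
gate : Seq → ℕ → Seq → Seq
gate s zero h = h
gate s (suc k) h i = not (s (suc i)) ∧ gate s k h (suc (suc i))

γˢ : ℕ → Seq → Seq
γˢ k s = gate s k s

Γˢ : Poly → Seq → Seq
Γˢ p s i = ⟦ p ⟧ (λ t → γˢ t s i)

2+i+2*k : ∀ i k → suc (suc i) + 2 * k ≡ i + 2 * suc k
2+i+2*k = solve-∀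

gate-cong : ∀ {s s′} k {h h′} → s ≗ s′ → h ≗ h′ → gate s k h ≗ gate s′ k h′
gate-cong zero s≗s′ h≗h′ i = h≗h′ i
gate-cong (suc k) s≗s′ h≗h′ i =
  cong₂ _∧_ (cong not (s≗s′ (suc i))) (gate-cong k s≗s′ h≗h′ (suc (suc i)))

gate-+ : ∀ s a b h → gate s (a + b) h ≗ gate s a (gate s b h)
gate-+ s zero b h i = refl
gate-+ s (suc a) b h i = cong (not (s (suc i)) ∧_) (gate-+ s a b h (suc (suc i)))

gate-factor : ∀ s k h i → gate s k h i ≡ gate s k (λ _ → true) i ∧ h (i + 2 * k)
gate-factor s zero h i = cong h (sym (ℕ.+-identityʳ i))
gate-factor s (suc k) h i = begin
  not (s (suc i)) ∧ gate s k h (suc (suc i))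
    ≡⟨ cong (not (s (suc i)) ∧_) (gate-factor s k h (suc (suc i))) ⟩
  not (s (suc i)) ∧ (gate s k (λ _ → true) (suc (suc i)) ∧ h (suc (suc i) + 2 * k))
    ≡⟨ sym (∧-assoc (not (s (suc i))) _ _) ⟩
  (not (s (suc i)) ∧ gate s k (λ _ → true) (suc (suc i))) ∧ h (suc (suc i) + 2 * k)
    ≡⟨ cong (λ j → gate s (suc k) (λ _ → true) i ∧ h j) (2+i+2*k i k) ⟩
  gate s (suc k) (λ _ → true) i ∧ h (i + 2 * suc k) ∎
  where open ≡-Reasoning

gate-periodic : ∀ {N s h} → Periodic N s → Periodic N h → ∀ k → Periodic N (gate s k h)
gate-periodic ps ph zero i = ph i
gate-periodic ps ph (suc k) i = cong₂ _∧_ (cong not (ps (suc i))) (gate-periodic ps ph k (suc (suc i)))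

gate-open : ∀ s k h i → (∀ l → l < k → s (suc (i + 2 * l)) ≡ false) → gate s k h i ≡ h (i + 2 * k)
gate-open s zero h i _ = cong h (sym (ℕ.+-identityʳ i))
gate-open s (suc k) h i odd≡false = cong₂ _∧_
  (cong not (trans (cong (s ∘ suc) (sym (ℕ.+-identityʳ i))) (odd≡false 0 (s≤s z≤n))))
  (trans (gate-open s k h (suc (suc i)) λ l l<k →
            trans (cong (s ∘ suc) (2+i+2*k i l)) (odd≡false (suc l) (s≤s l<k)))
         (cong h (2+i+2*k i k)))

gate-closed : ∀ s k h i l → l < k → s (suc (i + 2 * l)) ≡ true → gate s k h i ≡ false
gate-closed s (suc k) h i zero _ s-odd≡true =
  cong (λ b → not b ∧ gate s k h (suc (suc i))) (trans (cong (s ∘ suc) (sym (ℕ.+-identityʳ i))) s-odd≡true)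
gate-closed s (suc k) h i (suc l) (s≤s l<k) s-odd≡true =
  trans (cong (not (s (suc i)) ∧_) (gate-closed s k h (suc (suc i)) l l<k
          (trans (cong (s ∘ suc) (2+i+2*k i l)) s-odd≡true)))
        (∧-zeroʳ _)

γˢ-orthogonal : ∀ p q s j → γˢ p s (suc j) ∧ γˢ (suc q) s j ≡ false
γˢ-orthogonal zero q s j with s (suc j)
... | true = refl
... | false = refl
γˢ-orthogonal (suc p) zero s j =
  trans (cong (_∧ _) (∧-comm (not (s (suc (suc j)))) _))
        (∧-∧-≡false (γˢ p s (suc (suc (suc j)))) (not (s (suc j))) (∧-inverseˡ (s (suc (suc j)))))
γˢ-orthogonal (suc p) (suc q) s j =
  ∧-∧-≡false (not (s (suc (suc j)))) (not (s (suc j))) (γˢ-orthogonal p q s (suc (suc j)))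

-- Apart from s_{i+1}, every term of Γ_b(s)_{i+1} is orthogonal to every γ_{2(k+t)}(s)_{i+2},
-- so the factor ¬ Γ_b(s)_{i+1} acts like ¬ s_{i+1}.
γˢ-Γˢ : ∀ b s k i → const b ≡ true → γˢ k (Γˢ b s) i ≡ ⟦ b ⟧ (λ t → γˢ (k + t) s i)
γˢ-Γˢ (true ∷ b) s zero i refl = refl
γˢ-Γˢ (true ∷ b) s (suc k) i refl = begin
  not (Γˢ (true ∷ b) s (suc i)) ∧ γˢ k (Γˢ (true ∷ b) s) (suc (suc i))
    ≡⟨ cong (not (Γˢ (true ∷ b) s (suc i)) ∧_) (γˢ-Γˢ (true ∷ b) s k (suc (suc i)) refl) ⟩
  not (s (suc i) xor ⟦ b ⟧ (λ u → γˢ (suc u) s (suc i))) ∧ ⟦ true ∷ b ⟧ (λ t → γˢ (k + t) s (suc (suc i)))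
    ≡⟨ not-xor-∧ (s (suc i)) (⟦⟧-orthogonal (true ∷ b) b {λ t → γˢ (k + t) s (suc (suc i))} {λ u → γˢ (suc u) s (suc i)}
         λ t u → γˢ-orthogonal (k + t) u s (suc i)) ⟩
  not (s (suc i)) ∧ ⟦ true ∷ b ⟧ (λ t → γˢ (k + t) s (suc (suc i)))
    ≡⟨ sym (⟦⟧-∧ˢ (true ∷ b) (not (s (suc i))) (λ t → γˢ (k + t) s (suc (suc i)))) ⟩
  ⟦ true ∷ b ⟧ (λ t → γˢ (suc k + t) s i) ∎
  where open ≡-Reasoning

Γˢ-∘ : ∀ a b s i → const b ≡ true → Γˢ a (Γˢ b s) i ≡ Γˢ (a *ₚ b) s i
Γˢ-∘ a b s i const-b = trans (⟦⟧-cong a λ k → γˢ-Γˢ b s k i const-b) (sym (⟦⟧-* a b (λ t → γˢ t s i)))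

γˢ-period : ∀ M s → Periodic (2 * M) s → ∀ k i → γˢ (k + 2 * M) s i ≡ γˢ (k + M) s i
γˢ-period M s s-periodic k i = begin
  gate s (k + 2 * M) s i        ≡⟨ gate-+ s k (2 * M) s i ⟩
  gate s k (gate s (2 * M) s) i ≡⟨ gate-cong k (λ _ → refl) double≗single i ⟩
  gate s k (gate s M s) i       ≡⟨ sym (gate-+ s k M s i) ⟩
  gate s (k + M) s i            ∎
  where
  open ≡-Reasoning
  double≗single : gate s (2 * M) s ≗ gate s M s
  double≗single j = begin
    gate s (2 * M) s j             ≡⟨ cong (λ m → gate s (M + m) s j) (ℕ.+-identityʳ M) ⟩
    gate s (M + M) s j             ≡⟨ gate-+ s M M s j ⟩
    gate s M (gate s M s) j        ≡⟨ gate-factor s M _ j ⟩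
    G ∧ gate s M s (j + 2 * M)     ≡⟨ cong (G ∧_) (gate-periodic s-periodic s-periodic M j) ⟩
    G ∧ gate s M s j               ≡⟨ cong (G ∧_) (gate-factor s M s j) ⟩
    G ∧ (G ∧ s (j + 2 * M))        ≡⟨ sym (∧-assoc G G _) ⟩
    (G ∧ G) ∧ s (j + 2 * M)        ≡⟨ cong (_∧ s (j + 2 * M)) (∧-idem G) ⟩
    G ∧ s (j + 2 * M)              ≡⟨ sym (gate-factor s M s j) ⟩
    gate s M s j                   ∎
    where G = gate s M (λ _ → true) j

γˢ-annihilated : ∀ M s i → Periodic (2 * M) s → Annihilates (monomial (2 * M) +ₚ monomial M) (λ t → γˢ t s i)
γˢ-annihilated M s i s-periodic t = begin
  ⟦ monomial (2 * M) +ₚ monomial M ⟧ (λ u → γˢ (t + u) s i)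
    ≡⟨ ⟦⟧-+ (monomial (2 * M)) (monomial M) _ ⟩
  ⟦ monomial (2 * M) ⟧ (λ u → γˢ (t + u) s i) xor ⟦ monomial M ⟧ (λ u → γˢ (t + u) s i)
    ≡⟨ cong₂ _xor_ (⟦⟧-monomial (2 * M) _) (⟦⟧-monomial M _) ⟩
  γˢ (t + 2 * M) s i xor γˢ (t + M) s i
    ≡⟨ cong (_xor γˢ (t + M) s i) (γˢ-period M s s-periodic t i) ⟩
  γˢ (t + M) s i xor γˢ (t + M) s i
    ≡⟨ xor-same (γˢ (t + M) s i) ⟩
  false ∎
  where open ≡-Reasoning

Γˢ-cong : ∀ p {s s′} → s ≗ s′ → Γˢ p s ≗ Γˢ p s′
Γˢ-cong p s≗s′ i = ⟦⟧-cong p λ t → gate-cong t s≗s′ s≗s′ i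

-- Vectors as periodic streams

-- x is read as the periodic stream i ↦ x_{i mod n}.
str : ∀ {k} → V (suc k) → Seq
str x i = head (Sᵏ i x)

Sᵏ-suc : ∀ {k} t (x : V k) → Sᵏ (suc t) x ≡ Sᵏ t (S x)
Sᵏ-suc zero x = refl
Sᵏ-suc (suc t) x = cong S (Sᵏ-suc t x)

Sᵏ-+ : ∀ {k} i j (x : V k) → Sᵏ i (Sᵏ j x) ≡ Sᵏ (i + j) x
Sᵏ-+ zero j x = refl
Sᵏ-+ (suc i) j x = cong S (Sᵏ-+ i j x)

toList-Sᵏ-rotates : ∀ {k} (x : V k) l₁ l₂ → toList x ≡ l₁ ++ l₂ → toList (Sᵏ (length l₁) x) ≡ l₂ ++ l₁
toList-Sᵏ-rotates x [] l₂ x≡l₂ = trans x≡l₂ (sym (List.++-identityʳ l₂))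
toList-Sᵏ-rotates (a ∷ x) (b ∷ l₁) l₂ a∷x≡b∷l = begin
  toList (Sᵏ (suc (length l₁)) (a ∷ x))  ≡⟨ cong toList (Sᵏ-suc (length l₁) (a ∷ x)) ⟩
  toList (Sᵏ (length l₁) (x ∷ʳ a))       ≡⟨ toList-Sᵏ-rotates (x ∷ʳ a) l₁ (l₂ ++ b ∷ []) x∷ʳa≡ ⟩
  (l₂ ++ b ∷ []) ++ l₁                   ≡⟨ List.++-assoc l₂ (b ∷ []) l₁ ⟩
  l₂ ++ b ∷ l₁                           ∎
  where
  open ≡-Reasoning
  x∷ʳa≡ : toList (x ∷ʳ a) ≡ l₁ ++ (l₂ ++ b ∷ [])
  x∷ʳa≡ = begin
    toList (x ∷ʳ a)        ≡⟨ Vec.toList-∷ʳ a x ⟩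
    toList x ++ a ∷ []     ≡⟨ cong₂ (λ u v → u ++ v ∷ []) (List.∷-injectiveʳ a∷x≡b∷l) (List.∷-injectiveˡ a∷x≡b∷l) ⟩
    (l₁ ++ l₂) ++ b ∷ []   ≡⟨ List.++-assoc l₁ l₂ (b ∷ []) ⟩
    l₁ ++ (l₂ ++ b ∷ [])   ∎

Sᵏ-length : ∀ {k} (x : V k) → Sᵏ k x ≡ x
Sᵏ-length {k} x = trans (sym (Vec.cast-is-id refl (Sᵏ k x))) (Vec.toList-injective refl (Sᵏ k x) x (begin
  toList (Sᵏ k x)                   ≡⟨ cong (λ m → toList (Sᵏ m x)) (sym (Vec.length-toList x)) ⟩
  toList (Sᵏ (length (toList x)) x) ≡⟨ toList-Sᵏ-rotates x (toList x) [] (sym (List.++-identityʳ (toList x))) ⟩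
  toList x                          ∎))
  where open ≡-Reasoning

str-Sᵏ : ∀ {k} j (x : V (suc k)) i → str (Sᵏ j x) i ≡ str x (i + j)
str-Sᵏ j x i = cong head (Sᵏ-+ i j x)

str-periodic : ∀ {k} (x : V (suc k)) → Periodic (suc k) (str x)
str-periodic {k} x i = trans (sym (str-Sᵏ (suc k) x i)) (cong (λ y → str y i) (Sᵏ-length x))

zipWith-∷ʳ : ∀ {k} (f : Bool → Bool → Bool) (u v : V k) a b →
             zipWith f (u ∷ʳ a) (v ∷ʳ b) ≡ zipWith f u v ∷ʳ f a b
zipWith-∷ʳ f [] [] a b = refl
zipWith-∷ʳ f (c ∷ u) (d ∷ v) a b = cong (f c d ∷_) (zipWith-∷ʳ f u v a b)

Sᵏ-zipWith : ∀ {k} t (f : Bool → Bool → Bool) (u v : V k) → Sᵏ t (zipWith f u v) ≡ zipWith f (Sᵏ t u) (Sᵏ t v)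
Sᵏ-zipWith zero f u v = refl
Sᵏ-zipWith (suc t) f u v = trans (cong S (Sᵏ-zipWith t f u v)) (S-zipWith (Sᵏ t u) (Sᵏ t v))
  where
  S-zipWith : ∀ {k} (u v : V k) → S (zipWith f u v) ≡ zipWith f (S u) (S v)
  S-zipWith [] [] = refl
  S-zipWith (a ∷ u) (b ∷ v) = sym (zipWith-∷ʳ f u v a b)

str-zipWith : ∀ {k} (f : Bool → Bool → Bool) (u v : V (suc k)) i → str (zipWith f u v) i ≡ f (str u i) (str v i)
str-zipWith f u v i = trans (cong head (Sᵏ-zipWith i f u v)) (head-zipWith (Sᵏ i u) (Sᵏ i v))
  where
  head-zipWith : ∀ {k} (u v : V (suc k)) → head (zipWith f u v) ≡ f (head u) (head v)
  head-zipWith (a ∷ u) (b ∷ v) = refl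

str-replicate : ∀ {k} (a : Bool) i → str (replicate (suc k) a) i ≡ a
str-replicate {k} a i = cong head (Sᵏ-replicate i)
  where
  replicate-∷ʳ : ∀ m → replicate m a ∷ʳ a ≡ a ∷ replicate m a
  replicate-∷ʳ zero = refl
  replicate-∷ʳ (suc m) = cong (a ∷_) (replicate-∷ʳ m)
  Sᵏ-replicate : ∀ t → Sᵏ t (replicate (suc k) a) ≡ replicate (suc k) a
  Sᵏ-replicate zero = refl
  Sᵏ-replicate (suc t) = trans (cong S (Sᵏ-replicate t)) (replicate-∷ʳ k)

str-lookup : ∀ {k} t (x : V (suc k)) (t<1+k : t < suc k) → str x t ≡ lookup x (fromℕ< t<1+k)
str-lookup zero (a ∷ x) _ = refl
str-lookup {suc k} (suc t) (a ∷ x) (s≤s t<1+k) = begin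
  str (a ∷ x) (suc t)               ≡⟨ cong head (Sᵏ-suc t (a ∷ x)) ⟩
  str (x ∷ʳ a) t                    ≡⟨ str-lookup t (x ∷ʳ a) (ℕ.m<n⇒m<1+n t<1+k) ⟩
  lookup (x ∷ʳ a) (fromℕ< (ℕ.m<n⇒m<1+n t<1+k)) ≡⟨ lookup-∷ʳ x t<1+k {ℕ.m<n⇒m<1+n t<1+k} ⟩
  lookup x (fromℕ< t<1+k)           ∎
  where
  open ≡-Reasoning
  lookup-∷ʳ : ∀ {m t} (w : V m) (t<m : t < m) {t<1+m : t < suc m} → lookup (w ∷ʳ a) (fromℕ< t<1+m) ≡ lookup w (fromℕ< t<m)
  lookup-∷ʳ {t = zero} (b ∷ w) _ = refl
  lookup-∷ʳ {t = suc t} (b ∷ w) (s≤s t<m) {s≤s t<1+m} = lookup-∷ʳ w t<m {t<1+m}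

str-injective : ∀ {k} {u v : V (suc k)} → (∀ i → str u i ≡ str v i) → u ≡ v
str-injective {u = u} {v} u≐v =
  trans (sym (Vec.tabulate∘lookup u)) (trans (Vec.tabulate-cong lookup-≡) (Vec.tabulate∘lookup v))
  where
  lookup-≡ : ∀ j → lookup u j ≡ lookup v j
  lookup-≡ j = begin
    lookup u j                                ≡⟨ cong (lookup u) (sym (fromℕ<-toℕ j (toℕ<n j))) ⟩
    lookup u (fromℕ< (toℕ<n j))               ≡⟨ sym (str-lookup (toℕ j) u (toℕ<n j)) ⟩
    str u (toℕ j)                             ≡⟨ u≐v (toℕ j) ⟩
    str v (toℕ j)                             ≡⟨ str-lookup (toℕ j) v (toℕ<n j) ⟩
    lookup v (fromℕ< (toℕ<n j))               ≡⟨ cong (lookup v) (fromℕ<-toℕ j (toℕ<n j)) ⟩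
    lookup v j                                ∎
    where open ≡-Reasoning

str-tabulate : ∀ {k} (f : ℕ → Bool) t → t < suc k → str (tabulate {n = suc k} (f ∘ toℕ)) t ≡ f t
str-tabulate f t t<1+k =
  trans (str-lookup t _ t<1+k) (trans (Vec.lookup∘tabulate (f ∘ toℕ) _) (cong f (toℕ-fromℕ< t<1+k)))

gate-last : ∀ s m i → gate s (suc m) (λ _ → true) i ≡ gate s m (λ _ → true) i ∧ not (s (i + suc (2 * m)))
gate-last s m i = begin
  gate s (suc m) (λ _ → true) i
    ≡⟨ cong (λ k → gate s k (λ _ → true) i) (ℕ.+-comm 1 m) ⟩
  gate s (m + 1) (λ _ → true) i
    ≡⟨ gate-+ s m 1 (λ _ → true) i ⟩
  gate s m (gate s 1 (λ _ → true)) i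
    ≡⟨ gate-factor s m _ i ⟩
  gate s m (λ _ → true) i ∧ (not (s (suc (i + 2 * m))) ∧ true)
    ≡⟨ cong (gate s m (λ _ → true) i ∧_) (trans (∧-identityʳ _) (cong (not ∘ s) (sym (ℕ.+-suc i (2 * m))))) ⟩
  gate s m (λ _ → true) i ∧ not (s (i + suc (2 * m))) ∎
  where open ≡-Reasoning

module _ {k : ℕ} where

  str-P : ∀ m (x : V (suc k)) i → str (P m x) i ≡ gate (str x) m (λ _ → true) i
  str-P zero x i = str-replicate true i
  str-P (suc m) x i = begin
    str (P m x ⊙ (𝟙 ⊕ Sᵏ (suc (2 * m)) x)) i
      ≡⟨ str-zipWith _∧_ (P m x) _ i ⟩
    str (P m x) i ∧ str (𝟙 ⊕ Sᵏ (suc (2 * m)) x) i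
      ≡⟨ cong₂ _∧_ (str-P m x i) (str-zipWith _xor_ 𝟙 _ i) ⟩
    gate (str x) m (λ _ → true) i ∧ (str 𝟙 i xor str (Sᵏ (suc (2 * m)) x) i)
      ≡⟨ cong (λ b → gate (str x) m (λ _ → true) i ∧ (b xor str (Sᵏ (suc (2 * m)) x) i)) (str-replicate true i) ⟩
    gate (str x) m (λ _ → true) i ∧ not (str (Sᵏ (suc (2 * m)) x) i)
      ≡⟨ cong (λ b → gate (str x) m (λ _ → true) i ∧ not b) (str-Sᵏ (suc (2 * m)) x i) ⟩
    gate (str x) m (λ _ → true) i ∧ not (str x (i + suc (2 * m)))
      ≡⟨ sym (gate-last (str x) m i) ⟩
    gate (str x) (suc m) (λ _ → true) i ∎
    where open ≡-Reasoning

  str-γ : ∀ m (x : V (suc k)) i → str (γ m x) i ≡ γˢ m (str x) i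
  str-γ m x i = begin
    str (Sᵏ (2 * m) x ⊙ P m x) i                         ≡⟨ str-zipWith _∧_ _ (P m x) i ⟩
    str (Sᵏ (2 * m) x) i ∧ str (P m x) i                 ≡⟨ cong₂ _∧_ (str-Sᵏ (2 * m) x i) (str-P m x i) ⟩
    str x (i + 2 * m) ∧ gate (str x) m (λ _ → true) i    ≡⟨ ∧-comm (str x (i + 2 * m)) _ ⟩
    gate (str x) m (λ _ → true) i ∧ str x (i + 2 * m)    ≡⟨ sym (gate-factor (str x) m (str x) i) ⟩
    γˢ m (str x) i                                        ∎
    where open ≡-Reasoning

  str-combFrom : ∀ j p (x : V (suc k)) i → str (combFrom j p x) i ≡ ⟦ p ⟧ (λ t → γˢ (j + t) (str x) i)
  str-combFrom j [] x i = str-replicate false i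
  str-combFrom j (b ∷ p) x i = begin
    str ((if b then γ j x else 𝟘) ⊕ combFrom (suc j) p x) i
      ≡⟨ str-zipWith _xor_ _ _ i ⟩
    str (if b then γ j x else 𝟘) i xor str (combFrom (suc j) p x) i
      ≡⟨ cong₂ _xor_ (str-term b) (str-combFrom (suc j) p x i) ⟩
    (b ∧ γˢ j (str x) i) xor ⟦ p ⟧ (λ t → γˢ (suc j + t) (str x) i)
      ≡⟨ cong₂ (λ m h → (b ∧ γˢ m (str x) i) xor h) (sym (ℕ.+-identityʳ j))
               (⟦⟧-cong p λ t → cong (λ m → γˢ m (str x) i) (sym (ℕ.+-suc j t))) ⟩
    ⟦ b ∷ p ⟧ (λ t → γˢ (j + t) (str x) i) ∎
    where
    open ≡-Reasoning
    str-term : ∀ b → str (if b then γ j x else 𝟘) i ≡ b ∧ γˢ j (str x) i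
    str-term true = str-γ j x i
    str-term false = str-replicate false i

  str-Γfun : ∀ (a : Vec Bool (suc k)) x i → str (Γfun a x) i ≡ Γˢ (Vec.toList a) (str x) i
  str-Γfun a = str-combFrom 0 (Vec.toList a)

-- Coefficient vectors

toList-⊕ : ∀ {m} (u v : V m) → toList (u ⊕ v) ≡ toList u +ₚ toList v
toList-⊕ [] [] = refl
toList-⊕ (a ∷ u) (b ∷ v) = cong ((a xor b) ∷_) (toList-⊕ u v)

⊕-IsZero : ∀ {m} (u v : V m) → IsZeroₚ (toList (u ⊕ v)) → u ≡ v
⊕-IsZero [] [] _ = refl
⊕-IsZero (a ∷ u) (b ∷ v) (a⊕b≡false ∷ z) = cong₂ _∷_ (xor≡false⇒≡ a⊕b≡false) (⊕-IsZero u v z)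

⟦⟧-∷ʳ : ∀ {m} (w : V m) b g → ⟦ toList (w ∷ʳ b) ⟧ g ≡ ⟦ toList w ⟧ g xor (b ∧ g m)
⟦⟧-∷ʳ [] b g = xor-identityʳ _
⟦⟧-∷ʳ {suc m} (a ∷ w) b g = trans (cong ((a ∧ g 0) xor_) (⟦⟧-∷ʳ w b (g ∘ suc)))
                                  (sym (xor-assoc (a ∧ g 0) (⟦ toList w ⟧ (g ∘ suc)) (b ∧ g (suc m))))

⟦zeros⟧ : ∀ m g → ⟦ toList (tabulate {n = m} λ _ → false) ⟧ g ≡ false
⟦zeros⟧ zero g = refl
⟦zeros⟧ (suc m) g = ⟦zeros⟧ m (g ∘ suc)

⟦δ⟧ : ∀ m k g → k < m → ⟦ toList (tabulate {n = m} λ j → does (toℕ j ≟ k)) ⟧ g ≡ g k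
⟦δ⟧ (suc m) zero g _ = trans (cong (g 0 xor_) (⟦zeros⟧ m (g ∘ suc))) (xor-identityʳ (g 0))
⟦δ⟧ (suc m) (suc k) g (s≤s k<m) = ⟦δ⟧ m k (g ∘ suc) k<m

⌊m*2/2⌋≡m : ∀ m → ⌊ m * 2 /2⌋ ≡ m
⌊m*2/2⌋≡m zero = refl
⌊m*2/2⌋≡m (suc m) = cong suc (⌊m*2/2⌋≡m m)

2*-<⇒≢ : ∀ {a b} → a < b → 2 * a ≢ 2 * b
2*-<⇒≢ a<b = ℕ.<⇒≢ (ℕ.*-monoʳ-< 2 a<b)

module Main (M′ : ℕ) where

  M : ℕ
  M = suc M′

  n : ℕ
  n = M * 2

  n≡2*M : n ≡ 2 * M
  n≡2*M = ℕ.*-comm M 2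

  ⟦modulus⟧ : ∀ g → ⟦ modulus n ⟧ g ≡ g n xor g M
  ⟦modulus⟧ g = trans (⟦⟧-+ (monomial n) (monomial ⌊ n /2⌋) g)
                      (cong₂ _xor_ (⟦⟧-monomial n g) (trans (⟦⟧-monomial ⌊ n /2⌋ g) (cong g (⌊m*2/2⌋≡m M))))

  const-modulus : const (modulus n) ≡ false
  const-modulus = trans (const-+ (monomial n) (monomial ⌊ n /2⌋)) (cong (λ k → const (monomial k)) (⌊m*2/2⌋≡m M))

  str-periodic-2M : ∀ (x : V n) → Periodic (2 * M) (str x)
  str-periodic-2M x = subst (λ N → Periodic N (str x)) n≡2*M (str-periodic x)

  annihilates : ∀ (x : V n) i → Annihilates (modulus n) (λ t → γˢ t (str x) i)
  annihilates x i = subst (λ m → Annihilates m (λ t → γˢ t (str x) i)) (sym modulus≡)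
                          (γˢ-annihilated M (str x) i (str-periodic-2M x))
    where
    modulus≡ : modulus n ≡ monomial (2 * M) +ₚ monomial M
    modulus≡ = cong₂ (λ a b → monomial a +ₚ monomial b) n≡2*M (⌊m*2/2⌋≡m M)

  Γᵖ : Poly → V n → V n
  Γᵖ = combFrom 0

  Γᵖ-ext : ∀ p q → (∀ x i → Γˢ p (str x) i ≡ Γˢ q (str x) i) → Γᵖ p ≗ Γᵖ q
  Γᵖ-ext p q same x = str-injective λ i →
    trans (str-combFrom 0 p x i) (trans (same x i) (sym (str-combFrom 0 q x i)))

  Γᵖ-resp-≡[] : ∀ p q → p ≡[ n ] q → Γᵖ p ≗ Γᵖ q
  Γᵖ-resp-≡[] p q p≡q = Γᵖ-ext p q λ x i → ⟦⟧-resp-≡[] {n} {p} {q} (annihilates x i) p≡q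

  Γᵖ-∘ : ∀ a b → const b ≡ true → Γᵖ a ∘ Γᵖ b ≗ Γᵖ (a *ₚ b)
  Γᵖ-∘ a b const-b x = str-injective λ i → begin
    str (Γᵖ a (Γᵖ b x)) i              ≡⟨ str-combFrom 0 a (Γᵖ b x) i ⟩
    Γˢ a (str (Γᵖ b x)) i              ≡⟨ Γˢ-cong a (str-combFrom 0 b x) i ⟩
    Γˢ a (Γˢ b (str x)) i              ≡⟨ Γˢ-∘ a b (str x) i const-b ⟩
    Γˢ (a *ₚ b) (str x) i              ≡⟨ sym (str-combFrom 0 (a *ₚ b) x i) ⟩
    str (Γᵖ (a *ₚ b) x) i              ∎
    where open ≡-Reasoning

  Γᵖ-comm : ∀ a b → Γᵖ (a *ₚ b) ≗ Γᵖ (b *ₚ a)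
  Γᵖ-comm a b = Γᵖ-ext (a *ₚ b) (b *ₚ a) λ x i → ⟦⟧-*-comm a b (λ t → γˢ t (str x) i)

  Γᵖ-one : Γᵖ oneₚ ≗ id
  Γᵖ-one x = str-injective λ i → trans (str-combFrom 0 oneₚ x i) (xor-identityʳ (str x i))

  δ : ℕ → V n
  δ k = tabulate λ j → does (toℕ j ≟ k)

  -- [b + X·v] in R_n: the coefficient of X^n is folded back onto X^M.
  _∷ᴿ_ : Bool → V n → V n
  b ∷ᴿ v = (b ∷ init v) ⊕ Vec.map (last v ∧_) (δ M)

  ⟦∷ᴿ⟧ : ∀ b v g → ⟦ toList (b ∷ᴿ v) ⟧ g ≡ ⟦ b ∷ toList v ⟧ g xor (last v ∧ ⟦ modulus n ⟧ g)
  ⟦∷ᴿ⟧ b v g = begin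
    ⟦ toList (b ∷ᴿ v) ⟧ g
      ≡⟨ cong (λ p → ⟦ p ⟧ g) (trans (toList-⊕ (b ∷ init v) _) (cong ((b ∷ toList (init v)) +ₚ_) (Vec.toList-map (L ∧_) (δ M)))) ⟩
    ⟦ (b ∷ toList (init v)) +ₚ (L ·ₚ toList (δ M)) ⟧ g
      ≡⟨ ⟦⟧-+ (b ∷ toList (init v)) (L ·ₚ toList (δ M)) g ⟩
    ((b ∧ g 0) xor I) xor ⟦ L ·ₚ toList (δ M) ⟧ g
      ≡⟨ cong (((b ∧ g 0) xor I) xor_) (trans (⟦⟧-· L (toList (δ M)) g) (cong (L ∧_) (⟦δ⟧ n M g M<n))) ⟩
    ((b ∧ g 0) xor I) xor (L ∧ g M)
      ≡⟨ shuffle (b ∧ g 0) I L (g n) (g M) ⟩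
    ((b ∧ g 0) xor (I xor (L ∧ g n))) xor (L ∧ (g n xor g M))
      ≡⟨ cong₂ (λ u w → ((b ∧ g 0) xor u) xor (L ∧ w)) (sym ⟦v⟧) (sym (⟦modulus⟧ g)) ⟩
    ⟦ b ∷ toList v ⟧ g xor (L ∧ ⟦ modulus n ⟧ g) ∎
    where
    open ≡-Reasoning
    L = last v
    I = ⟦ toList (init v) ⟧ (g ∘ suc)
    M<n : M < n
    M<n = ℕ.m<m*n M 2 (s≤s (s≤s z≤n))
    ⟦v⟧ : ⟦ toList v ⟧ (g ∘ suc) ≡ I xor (L ∧ g n)
    ⟦v⟧ = trans (cong (λ w → ⟦ toList w ⟧ (g ∘ suc)) (proj₂ (proj₂ (initLast v)))) (⟦⟧-∷ʳ (init v) L (g ∘ suc))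
    shuffle : ∀ B I L Gn GM → (B xor I) xor (L ∧ GM) ≡ (B xor (I xor (L ∧ Gn))) xor (L ∧ (Gn xor GM))
    shuffle = solve 5 (λ B I L Gn GM → (B :+ I) :+ (L :* GM) := (B :+ (I :+ (L :* Gn))) :+ (L :* (Gn :+ GM))) refl
      where open xor-∧-Solver

  red : Poly → V n
  red [] = tabulate λ _ → false
  red (b ∷ p) = b ∷ᴿ red p

  red-≡ : ∀ p → toList (red p) ≡[ n ] p
  red-≡ [] = ≈⇒≡[] {n} {toList (red [])} {[]} (⟦zeros⟧ n)
  red-≡ (b ∷ p) with c , h ← ≡[]-elim n (toList (red p)) p (red-≡ p) =
    ≡[]-intro n (toList (red (b ∷ p))) (b ∷ p) (L ∷ c) λ g → begin
      ⟦ toList (b ∷ᴿ red p) ⟧ g xor ⟦ b ∷ p ⟧ g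
        ≡⟨ cong (_xor ⟦ b ∷ p ⟧ g) (⟦∷ᴿ⟧ b (red p) g) ⟩
      (((b ∧ g 0) xor R g) xor (L ∧ ⟦ modulus n ⟧ g)) xor ((b ∧ g 0) xor ⟦ p ⟧ (g ∘ suc))
        ≡⟨ shuffle (b ∧ g 0) (R g) (L ∧ ⟦ modulus n ⟧ g) (⟦ p ⟧ (g ∘ suc)) ⟩
      (L ∧ ⟦ modulus n ⟧ g) xor (R g xor ⟦ p ⟧ (g ∘ suc))
        ≡⟨ cong ((L ∧ ⟦ modulus n ⟧ g) xor_) (trans (h (g ∘ suc)) (⟦⟧-* c (modulus n) (g ∘ suc))) ⟩
      ⟦ L ∷ c ⟧ (λ t → ⟦ modulus n ⟧ (g ↑ t))
        ≡⟨ sym (⟦⟧-* (L ∷ c) (modulus n) g) ⟩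
      ⟦ (L ∷ c) *ₚ modulus n ⟧ g ∎
    where
    open ≡-Reasoning
    L = last (red p)
    R : Seq → Bool
    R g = ⟦ toList (red p) ⟧ (g ∘ suc)
    shuffle : ∀ B R T P → ((B xor R) xor T) xor (B xor P) ≡ T xor (R xor P)
    shuffle = solve 4 (λ B R T P → ((B :+ R) :+ T) :+ (B :+ P) := T :+ (R :+ P)) refl
      where open xor-∧-Solver

  lead-red : ∀ p → const p ≡ true → Lead (red p)
  lead-red p const-p = trans (const-resp-≡[] {n} {toList (red p)} {p} const-modulus (red-≡ p)) const-p

  Γᵖ-red : ∀ p → Γᵖ p ≗ Γfun (red p)
  Γᵖ-red p = Γᵖ-resp-≡[] p (toList (red p)) (≡[]-sym {n} {toList (red p)} {p} (red-≡ p))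

  n≡M+M : n ≡ M + M
  n≡M+M = trans n≡2*M (cong (M +_) (ℕ.+-identityʳ M))

  odd<n : ∀ {l} → l < M → suc (2 * l) < n
  odd<n {l} l<M = subst₂ _≤_ (sym (2+i+2*k 0 l)) (sym n≡2*M) (ℕ.*-monoʳ-≤ 2 l<M)

  even<n : ∀ {l} → l < M → 2 * l < n
  even<n l<M = ℕ.<-trans (ℕ.n<1+n _) (odd<n l<M)

  split-≥M : ∀ {j} → M ≤ j → j < n → ∃ λ r → r < M × M + r ≡ j
  split-≥M {j} M≤j j<n = j ∸ M , ℕ.+-cancelˡ-< M (j ∸ M) M (subst₂ _<_ (sym M+[j∸M]≡j) n≡M+M j<n) , M+[j∸M]≡j
    where M+[j∸M]≡j = ℕ.m+[n∸m]≡n M≤j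

  -- γ_{2j}(x)_0 = x_{2j} ∧ ∏_{l<j} ¬ x_{2l+1}: a 1 at position 2k+1 kills every γ_{2j} with j > k,
  -- and for j = M + r periodicity turns x_{2j} into x_{2r}.
  pair-at : ℕ → Seq
  pair-at k t = does (t ≟ 2 * k) ∨ does (t ≟ suc (2 * k))

  single-at : ℕ → Seq
  single-at r t = does (t ≟ 2 * r)

  test-pair : ℕ → V n
  test-pair k = tabulate (pair-at k ∘ toℕ)

  test-single : ℕ → V n
  test-single r = tabulate (single-at r ∘ toℕ)

  test-pair-hit : ∀ {k} → k < M → γˢ k (str (test-pair k)) 0 ≡ true
  test-pair-hit {k} k<M = trans (gate-open s k s 0 odd-false)
    (trans (str-tabulate (pair-at k) (2 * k) (even<n k<M)) (cong (_∨ does (2 * k ≟ suc (2 * k))) (dec-true (2 * k ≟ 2 * k) refl)))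
    where
    s = str (test-pair k)
    odd-false : ∀ l → l < k → s (suc (2 * l)) ≡ false
    odd-false l l<k = trans (str-tabulate (pair-at k) (suc (2 * l)) (odd<n (ℕ.<-trans l<k k<M)))
      (cong₂ _∨_ (dec-false (suc (2 * l) ≟ 2 * k) λ e → ℕ.even≢odd k l (sym e))
                 (dec-false (suc (2 * l) ≟ suc (2 * k)) λ e → 2*-<⇒≢ l<k (ℕ.suc-injective e)))

  test-pair-miss : ∀ {k j} → k < M → k < j → γˢ j (str (test-pair k)) 0 ≡ false
  test-pair-miss {k} {j} k<M k<j = gate-closed s j s 0 k k<j
    (trans (str-tabulate (pair-at k) (suc (2 * k)) (odd<n k<M))
           (trans (cong (does (suc (2 * k) ≟ 2 * k) ∨_) (dec-true (suc (2 * k) ≟ suc (2 * k)) refl)) (∨-zeroʳ _)))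
    where s = str (test-pair k)

  test-single-value : ∀ {r r′} → r′ < M → γˢ (M + r′) (str (test-single r)) 0 ≡ does (2 * r′ ≟ 2 * r)
  test-single-value {r} {r′} r′<M = begin
    gate s (M + r′) s 0          ≡⟨ gate-+ s M r′ s 0 ⟩
    gate s M (gate s r′ s) 0     ≡⟨ gate-open s M _ 0 (λ l l<M → odd-false l<M) ⟩
    gate s r′ s (0 + 2 * M)      ≡⟨ gate-periodic (str-periodic-2M _) (str-periodic-2M _) r′ 0 ⟩
    gate s r′ s 0                ≡⟨ gate-open s r′ s 0 (λ l l<r′ → odd-false (ℕ.<-trans l<r′ r′<M)) ⟩
    s (2 * r′)                   ≡⟨ str-tabulate (single-at r) (2 * r′) (even<n r′<M) ⟩
    does (2 * r′ ≟ 2 * r)        ∎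
    where
    open ≡-Reasoning
    s = str (test-single r)
    odd-false : ∀ {l} → l < M → s (suc (2 * l)) ≡ false
    odd-false {l} l<M = trans (str-tabulate (single-at r) (suc (2 * l)) (odd<n l<M))
                              (dec-false (suc (2 * l) ≟ 2 * r) λ e → ℕ.even≢odd r l (sym e))

  tests-separate : Separating (λ (x : V n) t → γˢ t (str x) 0) n
  tests-separate k k<n with k ℕ.<? M
  ... | yes k<M = test-pair k , test-pair-hit k<M , λ j k<j _ → test-pair-miss k<M k<j
  ... | no k≮M with r , r<M , M+r≡k ← split-≥M (ℕ.≮⇒≥ k≮M) k<n = test-single r , hit , miss
    where
    hit : γˢ k (str (test-single r)) 0 ≡ true
    hit = subst (λ m → γˢ m (str (test-single r)) 0 ≡ true) M+r≡k
                (trans (test-single-value {r} r<M) (dec-true (2 * r ≟ 2 * r) refl))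
    miss : ∀ j → k < j → j < n → γˢ j (str (test-single r)) 0 ≡ false
    miss j k<j j<n with r′ , r′<M , M+r′≡j ← split-≥M (ℕ.≤-trans (ℕ.≮⇒≥ k≮M) (ℕ.<⇒≤ k<j)) j<n =
      subst (λ m → γˢ m (str (test-single r)) 0 ≡ false) M+r′≡j
            (trans (test-single-value {r} r′<M) (dec-false (2 * r′ ≟ 2 * r) λ e → 2*-<⇒≢ r<r′ (sym e)))
      where
      r<r′ : r < r′
      r<r′ = ℕ.+-cancelˡ-< M r r′ (subst₂ _<_ (sym M+r≡k) (sym M+r′≡j) k<j)

  Γfun-injective : ∀ {a b : V n} → Γfun a ≗ Γfun b → a ≡ b
  Γfun-injective {a} {b} same = ⊕-IsZero a b
    (separating⇒IsZero _ n (toList (a ⊕ b)) tests-separate (ℕ.≤-reflexive (Vec.length-toList (a ⊕ b))) vanish)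
    where
    vanish : ∀ x → ⟦ toList (a ⊕ b) ⟧ (λ t → γˢ t (str x) 0) ≡ false
    vanish x = begin
      ⟦ toList (a ⊕ b) ⟧ g                         ≡⟨ cong (λ p → ⟦ p ⟧ g) (toList-⊕ a b) ⟩
      ⟦ toList a +ₚ toList b ⟧ g                   ≡⟨ ⟦⟧-+ (toList a) (toList b) g ⟩
      ⟦ toList a ⟧ g xor ⟦ toList b ⟧ g            ≡⟨ cong₂ _xor_ (sym (str-Γfun a x 0)) (sym (str-Γfun b x 0)) ⟩
      str (Γfun a x) 0 xor str (Γfun b x) 0        ≡⟨ cong (λ y → str y 0 xor str (Γfun b x) 0) (same x) ⟩
      str (Γfun b x) 0 xor str (Γfun b x) 0        ≡⟨ xor-same (str (Γfun b x) 0) ⟩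
      false                                        ∎
      where
      open ≡-Reasoning
      g = λ t → γˢ t (str x) 0

  Γᵖ-injective : ∀ p q → Γᵖ p ≗ Γᵖ q → p ≡[ n ] q
  Γᵖ-injective p q same =
    ≡[]-trans {n} {p} {toList (red q)} {q}
      (subst (λ v → p ≡[ n ] toList v) red-p≡red-q (≡[]-sym {n} {toList (red p)} {p} (red-≡ p)))
      (red-≡ q)
    where
    red-p≡red-q : red p ≡ red q
    red-p≡red-q = Γfun-injective λ x → trans (sym (Γᵖ-red p x)) (trans (same x) (Γᵖ-red q x))

  InG-resp : ∀ {f f′} → f ≗ f′ → InG n f′ → InG n f
  InG-resp f≗f′ (a , lead , f′≗Γ) = a , lead , λ x → trans (f≗f′ x) (f′≗Γ x)

  Γᵖ∈G : ∀ p → const p ≡ true → InG n (Γᵖ p)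
  Γᵖ∈G p const-p = red p , lead-red p const-p , Γᵖ-red p

  ∘-as-product : ∀ {f g} a b → Lead b → f ≗ Γfun a → g ≗ Γfun b → f ∘ g ≗ Γᵖ (toList a *ₚ toList b)
  ∘-as-product {f} {g} a b lead-b f≗ g≗ x =
    trans (f≗ (g x)) (trans (cong (Γfun a) (g≗ x)) (Γᵖ-∘ (toList a) (toList b) lead-b x))

  G-id : InG n id
  G-id = InG-resp (λ x → sym (Γᵖ-one x)) (Γᵖ∈G oneₚ refl)

  G-∘ : ∀ f g → InG n f → InG n g → InG n (f ∘ g)
  G-∘ f g (a , lead-a , f≗) (b , lead-b , g≗) =
    InG-resp (∘-as-product a b lead-b f≗ g≗) (Γᵖ∈G (toList a *ₚ toList b) (trans (const-* (toList a) (toList b)) (cong₂ _∧_ lead-a lead-b)))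

  G-comm : ∀ f g → InG n f → InG n g → f ∘ g ≗ g ∘ f
  G-comm f g (a , lead-a , f≗) (b , lead-b , g≗) x = begin
    f (g x)                           ≡⟨ ∘-as-product a b lead-b f≗ g≗ x ⟩
    Γᵖ (toList a *ₚ toList b) x       ≡⟨ Γᵖ-comm (toList a) (toList b) x ⟩
    Γᵖ (toList b *ₚ toList a) x       ≡⟨ sym (∘-as-product b a lead-a g≗ f≗ x) ⟩
    g (f x)                           ∎
    where open ≡-Reasoning

  -- Multiplication by a is injective because Γfun a is surjective, so by finiteness it hits 1.
  surjective⇒inverse : ∀ a → Lead a → (∀ y → ∃ λ x → Γfun a x ≡ y) →
                       ∃ λ b → red (toList b *ₚ toList a) ≡ red oneₚ
  surjective⇒inverse a lead-a surjective = injective⇒surjective (Vec-Bool↔Fin n) μ μ-injective (red oneₚ)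
    where
    μ : V n → V n
    μ c = red (toList c *ₚ toList a)
    Γ∘Γa≗Γμ : ∀ c → Γfun c ∘ Γfun a ≗ Γfun (μ c)
    Γ∘Γa≗Γμ c x = trans (∘-as-product c a lead-a (λ _ → refl) (λ _ → refl) x) (Γᵖ-red (toList c *ₚ toList a) x)
    μ-injective : ∀ {c c′} → μ c ≡ μ c′ → c ≡ c′
    μ-injective {c} {c′} μc≡μc′ = Γfun-injective λ y → let x , Γax≡y = surjective y in begin
      Γfun c y                 ≡⟨ cong (Γfun c) (sym Γax≡y) ⟩
      Γfun c (Γfun a x)        ≡⟨ Γ∘Γa≗Γμ c x ⟩
      Γfun (μ c) x             ≡⟨ cong (λ v → Γfun v x) μc≡μc′ ⟩
      Γfun (μ c′) x            ≡⟨ sym (Γ∘Γa≗Γμ c′ x) ⟩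
      Γfun c′ (Γfun a x)       ≡⟨ cong (Γfun c′) Γax≡y ⟩
      Γfun c′ y                ∎
      where open ≡-Reasoning

  InvG⇔Bijective : ∀ f → InG n f → (InvG n f ⇔ Bijective f)
  InvG⇔Bijective f (a , lead-a , f≗) = mk⇔ invertible⇒bijective surjective⇒invertible
    where
    invertible⇒bijective : InvG n f → Bijective f
    invertible⇒bijective (_ , g , _ , f∘g≗id , g∘f≗id) =
      (λ x y fx≡fy → trans (sym (g∘f≗id x)) (trans (cong g fx≡fy) (g∘f≗id y))) , λ y → g y , f∘g≗id y
    surjective⇒invertible : Bijective f → InvG n f
    surjective⇒invertible (_ , surjective) =
      (a , lead-a , f≗) , Γfun b , (b , lead-b , λ _ → refl) , f∘Γb≗id , Γb∘f≗id
      where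
      A = toList a
      inverse = surjective⇒inverse a lead-a λ y → let x , fx≡y = surjective y in x , trans (sym (f≗ x)) fx≡y
      b = proj₁ inverse
      BA≡1 : red (toList b *ₚ A) ≡ red oneₚ
      BA≡1 = proj₂ inverse
      Γ[BA]≗id : Γᵖ (toList b *ₚ A) ≗ id
      Γ[BA]≗id x = begin
        Γᵖ (toList b *ₚ A) x           ≡⟨ Γᵖ-red (toList b *ₚ A) x ⟩
        Γfun (red (toList b *ₚ A)) x   ≡⟨ cong (λ v → Γfun v x) BA≡1 ⟩
        Γfun (red oneₚ) x              ≡⟨ sym (Γᵖ-red oneₚ x) ⟩
        Γᵖ oneₚ x                      ≡⟨ Γᵖ-one x ⟩
        x                              ∎
        where open ≡-Reasoning
      lead-b : Lead b
      lead-b = begin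
        const (toList b)                      ≡⟨ sym (∧-identityʳ _) ⟩
        const (toList b) ∧ true               ≡⟨ cong (const (toList b) ∧_) (sym lead-a) ⟩
        const (toList b) ∧ const A            ≡⟨ sym (const-* (toList b) A) ⟩
        const (toList b *ₚ A)                 ≡⟨ sym (const-resp-≡[] {n} {toList (red (toList b *ₚ A))} {toList b *ₚ A}
                                                          const-modulus (red-≡ (toList b *ₚ A))) ⟩
        const (toList (red (toList b *ₚ A)))  ≡⟨ cong (const ∘ toList) BA≡1 ⟩
        const (toList (red oneₚ))             ≡⟨ lead-red oneₚ refl ⟩
        true                                  ∎
        where open ≡-Reasoning
      Γb∘f≗id : Γfun b ∘ f ≗ id
      Γb∘f≗id x = trans (∘-as-product b a lead-a (λ _ → refl) f≗ x) (Γ[BA]≗id x)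
      f∘Γb≗id : f ∘ Γfun b ≗ id
      f∘Γb≗id y = trans (∘-as-product a b lead-b f≗ (λ _ → refl) y) (trans (Γᵖ-comm A (toList b) y) (Γ[BA]≗id y))

  InvG-id : InvG n id
  InvG-id = G-id , id , G-id , (λ _ → refl) , (λ _ → refl)

  InvG-∘ : ∀ f g → InvG n f → InvG n g → InvG n (f ∘ g)
  InvG-∘ f g (f∈G , f⁻¹ , f⁻¹∈G , f∘f⁻¹ , f⁻¹∘f) (g∈G , g⁻¹ , g⁻¹∈G , g∘g⁻¹ , g⁻¹∘g) =
    G-∘ f g f∈G g∈G , g⁻¹ ∘ f⁻¹ , G-∘ g⁻¹ f⁻¹ g⁻¹∈G f⁻¹∈G ,
    (λ y → trans (cong f (g∘g⁻¹ (f⁻¹ y))) (f∘f⁻¹ y)) , (λ x → trans (cong g⁻¹ (f⁻¹∘f (g x))) (g⁻¹∘g x))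

  φ∈M : ∀ (a : V n) → Lead a → InM n (φ a)
  φ∈M a lead-a = toList a , lead-a , ≡[]-refl {n} (toList a)

  Γfun≗⇔φ≡ : ∀ (a b : V n) → Lead a → Lead b → ((Γfun a ≗ Γfun b) ⇔ (φ a ≡[ n ] φ b))
  Γfun≗⇔φ≡ a b _ _ = mk⇔ (Γᵖ-injective (toList a) (toList b)) (Γᵖ-resp-≡[] (toList a) (toList b))

  φ-surjective : ∀ r → InM n r → Σ (V n) λ a → Lead a × φ a ≡[ n ] r
  φ-surjective r (p , const-p , p≡r) =
    red r , lead-red r (trans (sym (const-resp-≡[] {n} {p} {r} const-modulus p≡r)) const-p) , red-≡ r

  φ-id : ∀ (a : V n) → Lead a → Γfun a ≗ id → φ a ≡[ n ] oneₚ
  φ-id a _ Γa≗id = Γᵖ-injective (toList a) oneₚ λ x → trans (Γa≗id x) (sym (Γᵖ-one x))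

  φ-∘ : ∀ (a b c : V n) → Lead a → Lead b → Lead c → Γfun c ≗ Γfun a ∘ Γfun b → φ c ≡[ n ] (φ a *ₚ φ b)
  φ-∘ a b c _ lead-b _ Γc≗ = Γᵖ-injective (toList c) (toList a *ₚ toList b) λ x →
    trans (Γc≗ x) (∘-as-product a b lead-b (λ _ → refl) (λ _ → refl) x)

  InvG⇔IsUnitR : ∀ (a : V n) → Lead a → (InvG n (Γfun a) ⇔ IsUnitR n (φ a))
  InvG⇔IsUnitR a lead-a = mk⇔ invertible⇒unit unit⇒invertible
    where
    A = toList a
    invertible⇒unit : InvG n (Γfun a) → IsUnitR n (φ a)
    invertible⇒unit (_ , g , (b , lead-b , g≗) , Γa∘g≗id , _) =
      toList b , Γᵖ-injective (A *ₚ toList b) oneₚ λ x →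
        trans (sym (∘-as-product a b lead-b (λ _ → refl) g≗ x)) (trans (Γa∘g≗id x) (sym (Γᵖ-one x)))
    unit⇒invertible : IsUnitR n (φ a) → InvG n (Γfun a)
    unit⇒invertible (s , As≡1) = (a , lead-a , λ _ → refl) , Γfun (red s) , (red s , lead-red s const-s , λ _ → refl) ,
      (λ y → trans (cong (Γfun a) (Γr≗Γs y)) (trans (Γᵖ-∘ A s const-s y) (As≗id y))) ,
      (λ x → trans (Γr≗Γs (Γfun a x)) (trans (Γᵖ-∘ s A lead-a x) (trans (Γᵖ-comm s A x) (As≗id x))))
      where
      const-s : const s ≡ true
      const-s = ∧-conicalʳ (const A) (const s) (trans (sym (const-* A s)) (const-resp-≡[] {n} {A *ₚ s} {oneₚ} const-modulus As≡1))
      Γr≗Γs : Γfun (red s) ≗ Γᵖ s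
      Γr≗Γs x = sym (Γᵖ-red s x)
      As≗id : Γᵖ (A *ₚ s) ≗ id
      As≗id x = trans (Γᵖ-resp-≡[] (A *ₚ s) oneₚ As≡1 x) (Γᵖ-one x)

  IsUnitR⇒InM : ∀ r → IsUnitR n r → InM n r
  IsUnitR⇒InM r (s , rs≡1) =
    r , ∧-conicalˡ (const r) (const s) (trans (sym (const-* r s)) (const-resp-≡[] {n} {r *ₚ s} {oneₚ} const-modulus rs≡1)) ,
    ≡[]-refl {n} r

theorem8 : (n : ℕ) → 2 ∣ n → 2 ≤ n →
    -- (a) G_n is a commutative monoid under composition
    ( InG n id
    × (∀ f g → InG n f → InG n g → InG n (f ∘ g))
    × (∀ f g → InG n f → InG n g → f ∘ g ≗ g ∘ f)
    -- φ : G_n → M_n is well defined, injective and surjective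
    × (∀ (a : Vec Bool n) → Lead a → InM n (φ a))
    × (∀ (a b : Vec Bool n) → Lead a → Lead b → ((Γfun a ≗ Γfun b) ⇔ (φ a ≡[ n ] φ b)))
    × (∀ r → InM n r → Σ (Vec Bool n) λ a → Lead a × φ a ≡[ n ] r)
    -- φ is a monoid homomorphism
    × (∀ (a : Vec Bool n) → Lead a → Γfun a ≗ id → φ a ≡[ n ] oneₚ)
    × (∀ (a b c : Vec Bool n) → Lead a → Lead b → Lead c →
         Γfun c ≗ Γfun a ∘ Γfun b → φ c ≡[ n ] (φ a *ₚ φ b)) )
    ×
    -- (b) G_n^* (invertible = bijective) is a group, isomorphic to R_n^* = M_n^* via φ
    ( (∀ f → InG n f → (InvG n f ⇔ Bijective f))
    × InvG n id
    × (∀ f g → InvG n f → InvG n g → InvG n (f ∘ g))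
    × (∀ (a : Vec Bool n) → Lead a → (InvG n (Γfun a) ⇔ IsUnitR n (φ a)))
    × (∀ r → IsUnitR n r → InM n r) )
theorem8 _ (divides zero refl) ()
theorem8 _ (divides (suc M′) refl) _ =
  (G-id , G-∘ , G-comm , φ∈M , Γfun≗⇔φ≡ , φ-surjective , φ-id , φ-∘) ,
  (InvG⇔Bijective , InvG-id , InvG-∘ , InvG⇔IsUnitR , IsUnitR⇒InM)
  where open Main M′
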